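{- Consider the game Slow Moore's $k$-Nim, $\text{Nim}^1_{n,\leq k}$: there are $n$ piles of tokens, positions are $x=(x_1,\ldots,x_n)$ with $0\le x_1\le\cdots\le x_n$ (coordinates reordered after each move), and by one move a player chooses at least $1$ and at most $k$ non-empty piles and removes exactly one token from each of them; the player making the last move wins (normal play). For the parity vector $p(x)=(p(x_1),\ldots,p(x_n))$, where $p(x_i)=e$ if $x_i$ is even and $p(x_i)=o$ if $x_i$ is odd, the Sprague-Grundy values $\mathcal{G}(x)$ for the cases $n=k=2$ and $n=3,k=2$ are uniquely defined by $p(x)$ as follows: (i) For $n=k=2$: $\mathcal{G}(x)=0$ if $p(x)=(e,e)$; $1$ if $p(x)=(e,o)$; $2$ if $p(x)=(o,o)$; $3$ if $p(x)=(o,e)$. (ii) For $n=3,k=2$: $\mathcal{G}(x)=0$ if $p(x)\in\{(e,e,e),(o,o,o)\}$; $1$ if $p(x)\in\{(e,e,o),(o,o,e)\}$; $2$ if $p(x)\in\{(e,o,o),(o,e,e)\}$; $3$ if $p(x)\in\{(e,o,e),(o,e,o)\}$.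
   Context: $\mathcal{G}$ denotes the Sprague-Grundy function of the normal version of the game. -}

module Defs where

open import Data.Nat using (ℕ; zero; suc; _+_; _≤ᵇ_; pred; _%_)
open import Data.Bool using (Bool; true; false; if_then_else_; _∧_)
open import Data.List using (List; []; _∷_; map; concatMap; length; filterᵇ)
open import Data.Bool.ListAction using (any)
open import Data.Vec using (Vec; []; _∷_; zipWith)
open import Data.Nat using (_≡ᵇ_)

-- The game graph is invariant under permuting coordinates, so we work with
-- unordered tuples; the paper's reordering x₁ ≤ ⋯ ≤ xₙ is imposed as a
-- hypothesis in the statement.

subsets : (n : ℕ) → List (Vec Bool n)
subsets zero = [] ∷ []
subsets (suc n) = concatMap (λ s → (false ∷ s) ∷ (true ∷ s) ∷ []) (subsets n)

count : ∀ {n} → Vec Bool n → ℕ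
count [] = 0
count (true ∷ s) = suc (count s)
count (false ∷ s) = count s

chosenNonEmpty : ∀ {n} → Vec Bool n → Vec ℕ n → Bool
chosenNonEmpty [] [] = true
chosenNonEmpty (true ∷ s) (zero ∷ x) = false
chosenNonEmpty (true ∷ s) (suc _ ∷ x) = chosenNonEmpty s x
chosenNonEmpty (false ∷ s) (_ ∷ x) = chosenNonEmpty s x

legal : ∀ {n} → ℕ → Vec ℕ n → Vec Bool n → Bool
legal k x s = (1 ≤ᵇ count s) ∧ (count s ≤ᵇ k) ∧ chosenNonEmpty s x

apply : ∀ {n} → Vec Bool n → Vec ℕ n → Vec ℕ n
apply = zipWith (λ b v → if b then pred v else v)

options : ∀ {n} → ℕ → Vec ℕ n → List (Vec ℕ n)
options {n} k x = map (λ s → apply s x) (filterᵇ (legal k x) (subsets n))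

_∈ᵇ_ : ℕ → List ℕ → Bool
m ∈ᵇ l = any (m ≡ᵇ_) l

mexSearch : ℕ → ℕ → List ℕ → ℕ
mexSearch m zero l = m
mexSearch m (suc f) l = if m ∈ᵇ l then mexSearch (suc m) f l else m

mex : List ℕ → ℕ
mex l = mexSearch 0 (length l) l

total : ∀ {n} → Vec ℕ n → ℕ
total [] = 0
total (v ∷ x) = v + total x

-- Sprague–Grundy function with fuel; every move decreases the total number
-- of tokens, so fuel = total x suffices (at total 0 there are no moves).
sgFuel : ∀ {n} → ℕ → ℕ → Vec ℕ n → ℕ
sgFuel k zero x = 0
sgFuel k (suc f) x = mex (map (sgFuel k f) (options k x))

𝒢 : ∀ {n} → (k : ℕ) → Vec ℕ n → ℕ
𝒢 k x = sgFuel k (total x) x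

data Parity : Set where
  e o : Parity

p : ℕ → Parity
p v with v % 2
... | zero = e
... | suc _ = o

module Submission where

-- Write a Grundy value below 4 by its two binary digits (high , low) and read the
-- parities e, o as the bits 0, 1.  For sorted positions the claim is the closed form
--   𝒢(x₁ , x₂)      = (p x₁         , p x₁ ⊕ p x₂)   (x₁ ≤ x₂),
--   𝒢(x₁ , x₂ , x₃) = (p x₁ ⊕ p x₂ , p x₂ ⊕ p x₃)   (x₁ ≤ x₂ ≤ x₃),
-- from which the parity tables of the paper are read off.
--
-- 1. Uniqueness: every legal move lowers the total number of tokens, so any
--    function satisfying the mex recursion at every position equals 𝒢.
-- 2. Two piles: the candidate bits₂ subtracts the common minimum (each unit of
--    it toggles the high digit).  It agrees with the closed form on both orders
--    of the piles; around any (y , z) the relative order of y and z falls into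
--    four classes, and in each the mex recursion is a check over parities.
-- 3. Three piles: bits₃ subtracts the common minimum down to a two-pile
--    position.  Positions with an empty pile are two-pile positions, positions
--    whose smallest pile is at least 2 inherit the recursion from the position
--    one step down, and the three cases of a pile with a single token use the
--    two-pile classification again.
-- 4. Proposition 7 then combines uniqueness with the closed forms.

open import Defs
open import Data.Nat using (ℕ; zero; suc; _+_; _≤_; _<_; z≤n; s≤s; s≤s⁻¹)
open import Data.Nat.Properties
  using (+-assoc; +-suc; ≤ᵇ⇒≤; m<m+n; ≤-refl; ≤-trans; n≤1+n; m≤n⇒m≤1+n; <⇒≤; <-cmp; m≤n⇒m<n∨m≡n)
open import Data.Bool using (Bool; true; false; not; _xor_; T; T?)
open import Data.Bool.Properties using (T-∧; not-involutive)
open import Data.Vec using (Vec; []; _∷_)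
open import Data.List using ([]; _∷_; map)
open import Data.List.Properties using (map-cong-local)
open import Data.List.Relation.Unary.All as All using (All; _∷_)
open import Data.List.Relation.Unary.All.Properties using (map⁺; all-filter)
open import Data.Product using (_×_; _,_; proj₂)
open import Data.Sum using (_⊎_; inj₁; inj₂; [_,_]′)
open import Function using (_∘_; Equivalence)
open import Relation.Binary using (tri<; tri≈; tri>)
open import Relation.Binary.PropositionalEquality
  using (_≡_; refl; sym; trans; cong; cong₂; subst; module ≡-Reasoning)

total-apply : ∀ {n} (s : Vec Bool n) (x : Vec ℕ n) →
              T (chosenNonEmpty s x) → total (apply s x) + count s ≡ total x
total-apply []          []          _ = refl
total-apply (true ∷ s)  (suc v ∷ x) h =
  trans (+-suc (v + total (apply s x)) (count s))
        (cong suc (trans (+-assoc v _ _) (cong (v +_) (total-apply s x h))))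
total-apply (false ∷ s) (v ∷ x)     h =
  trans (+-assoc v _ _) (cong (v +_) (total-apply s x h))

move-decreases : ∀ {n} k (x : Vec ℕ n) {s} → T (legal k x s) → total (apply s x) < total x
move-decreases k x {s} h with Equivalence.to T-∧ h
... | atLeastOne , rest =
  subst (total (apply s x) <_) (total-apply s x (proj₂ (Equivalence.to T-∧ rest)))
        (m<m+n (total (apply s x)) (≤ᵇ⇒≤ 1 (count s) atLeastOne))

options-decrease : ∀ {n} k (x : Vec ℕ n) → All (λ y → total y < total x) (options k x)
options-decrease {n} k x =
  map⁺ (All.map (λ {s} → move-decreases k x {s}) (all-filter (T? ∘ legal k x) (subsets n)))

no-options : ∀ {n} k (x : Vec ℕ n) → total x ≤ 0 → options k x ≡ []
no-options k x h with options k x | options-decrease k x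
... | []    | _          = refl
... | _ ∷ _ | y<x ∷ _    with ≤-trans y<x h
...   | ()

module _ {n : ℕ} (k : ℕ) (G : Vec ℕ n → ℕ)
         (mex-rule : ∀ x → mex (map G (options k x)) ≡ G x) where

  sgFuel-agrees : ∀ f x → total x ≤ f → sgFuel k f x ≡ G x
  sgFuel-agrees zero    x h =
    sym (trans (sym (mex-rule x)) (cong (mex ∘ map G) (no-options k x h)))
  sgFuel-agrees (suc f) x h =
    trans (cong mex (map-cong-local (All.map (λ {y} y<x → sgFuel-agrees f y (s≤s⁻¹ (≤-trans y<x h)))
                                             (options-decrease k x))))
          (mex-rule x)

  𝒢-unique : ∀ x → 𝒢 k x ≡ G x
  𝒢-unique x = sgFuel-agrees (total x) x ≤-refl

-- Parity as a bit, defined so that par (suc n) reduces to not (par n).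
par : ℕ → Bool
par zero    = false
par (suc n) = not (par n)

xor-not : ∀ a b → not a xor not b ≡ a xor b
xor-not false b = not-involutive b
xor-not true  b = refl

Bits : Set
Bits = Bool × Bool

value : Bits → ℕ
value (false , false) = 0
value (false , true)  = 1
value (true  , false) = 2
value (true  , true)  = 3

-- Removing a token from two piles of a two-pile position toggles the high digit.
toggleHigh : Bits → Bits
toggleHigh (a , b) = not a , b

bits₂ : ℕ → ℕ → Bits
bits₂ zero    z       = false , par z
bits₂ (suc y) zero    = false , par (suc y)
bits₂ (suc y) (suc z) = toggleHigh (bits₂ y z)

ordered : ℕ → ℕ → Bits
ordered u v = par u , par u xor par v

bits₂-≤ : ∀ {u v} → u ≤ v → bits₂ u v ≡ ordered u v
bits₂-≤ z≤n = refl
bits₂-≤ {suc u} {suc v} (s≤s h) =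
  trans (cong toggleHigh (bits₂-≤ h)) (cong (not (par u) ,_) (sym (xor-not (par u) (par v))))

bits₂-≥ : ∀ {u v} → v ≤ u → bits₂ u v ≡ ordered v u
bits₂-≥ {zero}  z≤n = refl
bits₂-≥ {suc u} z≤n = refl
bits₂-≥ {suc u} {suc v} (s≤s h) =
  trans (cong toggleHigh (bits₂-≥ h)) (cong (not (par v) ,_) (sym (xor-not (par v) (par u))))

-- The candidate digits at (y , z) and at the three neighbours that the mex
-- recursions below look at.
record Window (y z : ℕ) (h u r r² : Bits) : Set where
  field
    here   : bits₂ y z ≡ h
    up     : bits₂ y (suc z) ≡ u
    right  : bits₂ (suc y) z ≡ r
    right² : bits₂ (2 + y) z ≡ r²
open Window

-- According to whether z − y is at least 2, equal to 1 or 0, or negative, the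
-- closed form describes all four values of the window in terms of par y and par z.
data Around (y z : ℕ) : Set where
  far  : Window y z (ordered y z) (ordered y (suc z)) (ordered (suc y) z) (ordered (2 + y) z) → Around y z
  next : Window y z (ordered y (suc y)) (ordered y (2 + y)) (ordered (suc y) (suc y)) (ordered (suc y) (2 + y)) → Around y z
  same : Window y z (ordered y y) (ordered y (suc y)) (ordered y (suc y)) (ordered y (2 + y)) → Around y z
  past : Window y z (ordered z y) (ordered (suc z) y) (ordered z (suc y)) (ordered z (2 + y)) → Around y z

around : ∀ y z → Around y z
around y z with <-cmp y z
... | tri< y<z _ _ with m≤n⇒m<n∨m≡n y<z
...   | inj₁ y+1<z = far record
  { here = bits₂-≤ y≤z ; up = bits₂-≤ (m≤n⇒m≤1+n y≤z)
  ; right = bits₂-≤ (<⇒≤ y+1<z) ; right² = bits₂-≤ y+1<z }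
  where y≤z = <⇒≤ y<z
...   | inj₂ refl = next record
  { here = bits₂-≤ (n≤1+n y) ; up = bits₂-≤ (m≤n⇒m≤1+n (n≤1+n y))
  ; right = bits₂-≤ (≤-refl {suc y}) ; right² = bits₂-≥ (n≤1+n (suc y)) }
around y z | tri≈ _ refl _ = same record
  { here = bits₂-≤ (≤-refl {y}) ; up = bits₂-≤ (n≤1+n y)
  ; right = bits₂-≥ (n≤1+n y) ; right² = bits₂-≥ (m≤n⇒m≤1+n (n≤1+n y)) }
around y z | tri> _ _ z<y = past record
  { here = bits₂-≥ z≤y ; up = bits₂-≥ z<y
  ; right = bits₂-≥ (m≤n⇒m≤1+n z≤y) ; right² = bits₂-≥ (m≤n⇒m≤1+n (m≤n⇒m≤1+n z≤y)) }
  where z≤y = <⇒≤ z<y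

cand₂ : Vec ℕ 2 → ℕ
cand₂ (y ∷ z ∷ []) = value (bits₂ y z)

-- With a nonempty
-- pile on each side, the three options are the window around (y , z), and in each
-- of the four classes the claim is a check over the parities of y and z.
mex-rule₂ : ∀ y z → mex (map cand₂ (options 2 (y ∷ z ∷ []))) ≡ value (bits₂ y z)
mex-rule₂ zero zero = refl
mex-rule₂ zero (suc z) with par z
... | false = refl
... | true  = refl
mex-rule₂ (suc y) zero rewrite bits₂-≥ {y} z≤n with par y
... | false = refl
... | true  = refl
mex-rule₂ (suc y) (suc z) with around y z
... | far w rewrite here w | up w | right w with par y | par z
...   | false | false = refl
...   | false | true  = refl
...   | true  | false = refl
...   | true  | true  = refl
mex-rule₂ (suc y) (suc z) | next w rewrite here w | up w | right w with par y
...   | false = refl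
...   | true  = refl
mex-rule₂ (suc y) (suc z) | same w rewrite here w | up w | right w with par y
...   | false = refl
...   | true  = refl
mex-rule₂ (suc y) (suc z) | past w rewrite here w | up w | right w with par y | par z
...   | false | false = refl
...   | false | true  = refl
...   | true  | false = refl
...   | true  | true  = refl

bits₃ : ℕ → ℕ → ℕ → Bits
bits₃ zero    y       z       = bits₂ y z
bits₃ (suc x) zero    z       = bits₂ (suc x) z
bits₃ (suc x) (suc y) zero    = bits₂ (suc x) (suc y)
bits₃ (suc x) (suc y) (suc z) = bits₃ x y z

cand₃ : Vec ℕ 3 → ℕ
cand₃ (x ∷ y ∷ z ∷ []) = value (bits₃ x y z)

bits₃-middle-empty : ∀ x z → bits₃ x zero z ≡ bits₂ x z
bits₃-middle-empty zero    z = refl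
bits₃-middle-empty (suc x) z = refl

bits₃-last-empty : ∀ x y → bits₃ x y zero ≡ bits₂ x y
bits₃-last-empty zero    zero    = refl
bits₃-last-empty zero    (suc y) = refl
bits₃-last-empty (suc x) zero    = refl
bits₃-last-empty (suc x) (suc y) = refl

-- The three cases of a smallest pile holding a single token: moves emptying it
-- lead to two-pile positions, so the option values lie in a two-pile window.
single-first : ∀ y z → mex (map cand₃ (options 2 (1 ∷ suc y ∷ suc z ∷ []))) ≡ value (bits₃ 1 (suc y) (suc z))
single-first zero zero = refl
single-first zero (suc z) with par z
... | false = refl
... | true  = refl
single-first (suc y) zero rewrite bits₂-≥ {y} z≤n with par y
... | false = refl
... | true  = refl
single-first (suc y) (suc z) with around y z
... | far w rewrite here w | up w | right w with par y | par z
...   | false | false = refl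
...   | false | true  = refl
...   | true  | false = refl
...   | true  | true  = refl
single-first (suc y) (suc z) | next w rewrite here w | up w | right w with par y
...   | false = refl
...   | true  = refl
single-first (suc y) (suc z) | same w rewrite here w | up w | right w with par y
...   | false = refl
...   | true  = refl
single-first (suc y) (suc z) | past w rewrite here w | up w | right w with par y | par z
...   | false | false = refl
...   | false | true  = refl
...   | true  | false = refl
...   | true  | true  = refl

single-second : ∀ x z → mex (map cand₃ (options 2 (suc (suc x) ∷ 1 ∷ suc z ∷ []))) ≡ value (bits₃ (suc (suc x)) 1 (suc z))
single-second zero zero = refl
single-second zero (suc zero) = refl
single-second zero (suc (suc z)) with par z
... | false = refl
... | true  = refl
single-second (suc zero) zero = refl
single-second (suc (suc x)) zero with par x
... | false = refl
... | true  = refl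
single-second (suc x) (suc z) with around x z
... | far w rewrite here w | right w | right² w with par x | par z
...   | false | false = refl
...   | false | true  = refl
...   | true  | false = refl
...   | true  | true  = refl
single-second (suc x) (suc z) | next w rewrite here w | right w | right² w with par x
...   | false = refl
...   | true  = refl
single-second (suc x) (suc z) | same w rewrite here w | right w | right² w with par x
...   | false = refl
...   | true  = refl
single-second (suc x) (suc z) | past w rewrite here w | right w | right² w with par x | par z
...   | false | false = refl
...   | false | true  = refl
...   | true  | false = refl
...   | true  | true  = refl

single-third : ∀ x y → mex (map cand₃ (options 2 (suc (suc x) ∷ suc (suc y) ∷ 1 ∷ []))) ≡ value (bits₃ (suc (suc x)) (suc (suc y)) 1)
single-third zero zero = refl
single-third zero (suc zero) = refl
single-third zero (suc (suc y)) with par y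
... | false = refl
... | true  = refl
single-third (suc zero) zero = refl
single-third (suc (suc x)) zero with par x
... | false = refl
... | true  = refl
single-third (suc x) (suc y) with around x y
... | far w rewrite here w | up w | right w with par x | par y
...   | false | false = refl
...   | false | true  = refl
...   | true  | false = refl
...   | true  | true  = refl
single-third (suc x) (suc y) | next w rewrite here w | up w | right w with par x
...   | false = refl
...   | true  = refl
single-third (suc x) (suc y) | same w rewrite here w | up w | right w with par x
...   | false = refl
...   | true  = refl
single-third (suc x) (suc y) | past w rewrite here w | up w | right w with par x | par y
...   | false | false = refl
...   | false | true  = refl
...   | true  | false = refl
...   | true  | true  = refl

-- An empty
-- pile reduces to mex-rule₂; if every pile has at least two tokens, the options
-- and the value agree with those one step down the diagonal.
mex-rule₃ : ∀ x y z → mex (map cand₃ (options 2 (x ∷ y ∷ z ∷ []))) ≡ value (bits₃ x y z)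
mex-rule₃ zero          zero          zero          = refl
mex-rule₃ zero          zero          (suc z)       = mex-rule₂ zero (suc z)
mex-rule₃ zero          (suc y)       zero          = mex-rule₂ (suc y) zero
mex-rule₃ zero          (suc y)       (suc z)       = mex-rule₂ (suc y) (suc z)
mex-rule₃ (suc x)       zero          zero
  rewrite bits₃-middle-empty x zero = mex-rule₂ (suc x) zero
mex-rule₃ (suc x)       zero          (suc z)
  rewrite bits₃-middle-empty x (suc z) | bits₃-middle-empty x z = mex-rule₂ (suc x) (suc z)
mex-rule₃ (suc x)       (suc y)       zero
  rewrite bits₃-last-empty x (suc y) | bits₃-last-empty (suc x) y | bits₃-last-empty x y =
    mex-rule₂ (suc x) (suc y)
mex-rule₃ (suc zero)    (suc y)       (suc z)       = single-first y z
mex-rule₃ (suc (suc x)) (suc zero)    (suc z)       = single-second x z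
mex-rule₃ (suc (suc x)) (suc (suc y)) (suc zero)    = single-third x y
mex-rule₃ (suc (suc x)) (suc (suc y)) (suc (suc z)) = mex-rule₃ (suc x) (suc y) (suc z)

bits₃-sorted : ∀ {x y z} → x ≤ y → y ≤ z → bits₃ x y z ≡ (par x xor par y , par y xor par z)
bits₃-sorted z≤n y≤z = bits₂-≤ y≤z
bits₃-sorted {suc x} {suc y} {suc z} (s≤s x≤y) (s≤s y≤z) =
  trans (bits₃-sorted x≤y y≤z)
        (sym (cong₂ _,_ (xor-not (par x) (par y)) (xor-not (par y) (par z))))

bit : Parity → Bool
bit e = false
bit o = true

par-bit : ∀ v → bit (p v) ≡ par v
par-bit zero          = refl
par-bit (suc zero)    = refl
par-bit (suc (suc v)) = trans (par-bit v) (sym (not-involutive (par v)))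

par-from : ∀ v {a} → p v ≡ a → par v ≡ bit a
par-from v h = trans (sym (par-bit v)) (cong bit h)

code₂ : Parity → Parity → ℕ
code₂ a b = value (bit a , bit a xor bit b)

code₃ : Parity → Parity → Parity → ℕ
code₃ a b c = value (bit a xor bit b , bit b xor bit c)

two-piles : ∀ {x₁ x₂} → x₁ ≤ x₂ → ∀ {a b} → p x₁ ≡ a → p x₂ ≡ b → 𝒢 2 (x₁ ∷ x₂ ∷ []) ≡ code₂ a b
two-piles {x₁} {x₂} x₁≤x₂ {a} {b} h₁ h₂ = begin
  𝒢 2 (x₁ ∷ x₂ ∷ [])                 ≡⟨ 𝒢-unique 2 cand₂ (λ { (y ∷ z ∷ []) → mex-rule₂ y z }) (x₁ ∷ x₂ ∷ []) ⟩
  value (bits₂ x₁ x₂)                ≡⟨ cong value (bits₂-≤ x₁≤x₂) ⟩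
  value (par x₁ , par x₁ xor par x₂) ≡⟨ cong₂ (λ u v → value (u , u xor v)) (par-from x₁ h₁) (par-from x₂ h₂) ⟩
  code₂ a b                          ∎
  where open ≡-Reasoning

three-piles : ∀ {x₁ x₂ x₃} → x₁ ≤ x₂ → x₂ ≤ x₃ → ∀ {a b c} →
              p x₁ ≡ a × p x₂ ≡ b × p x₃ ≡ c → 𝒢 2 (x₁ ∷ x₂ ∷ x₃ ∷ []) ≡ code₃ a b c
three-piles {x₁} {x₂} {x₃} x₁≤x₂ x₂≤x₃ {a} {b} {c} (h₁ , h₂ , h₃) = begin
  𝒢 2 (x₁ ∷ x₂ ∷ x₃ ∷ [])                        ≡⟨ 𝒢-unique 2 cand₃ (λ { (x ∷ y ∷ z ∷ []) → mex-rule₃ x y z }) (x₁ ∷ x₂ ∷ x₃ ∷ []) ⟩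
  value (bits₃ x₁ x₂ x₃)                         ≡⟨ cong value (bits₃-sorted x₁≤x₂ x₂≤x₃) ⟩
  value (par x₁ xor par x₂ , par x₂ xor par x₃) ≡⟨ cong₂ (λ u w → value (u xor par x₂ , par x₂ xor w)) (par-from x₁ h₁) (par-from x₃ h₃) ⟩
  value (bit a xor par x₂ , par x₂ xor bit c)   ≡⟨ cong (λ v → value (bit a xor v , v xor bit c)) (par-from x₂ h₂) ⟩
  code₃ a b c                                    ∎
  where open ≡-Reasoning

proposition7 :
    (∀ (x₁ x₂ : ℕ) → x₁ ≤ x₂ →
      (p x₁ ≡ e → p x₂ ≡ e → 𝒢 2 (x₁ ∷ x₂ ∷ []) ≡ 0) ×
      (p x₁ ≡ e → p x₂ ≡ o → 𝒢 2 (x₁ ∷ x₂ ∷ []) ≡ 1) ×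
      (p x₁ ≡ o → p x₂ ≡ o → 𝒢 2 (x₁ ∷ x₂ ∷ []) ≡ 2) ×
      (p x₁ ≡ o → p x₂ ≡ e → 𝒢 2 (x₁ ∷ x₂ ∷ []) ≡ 3))
    ×
    (∀ (x₁ x₂ x₃ : ℕ) → x₁ ≤ x₂ → x₂ ≤ x₃ →
      ((p x₁ ≡ e × p x₂ ≡ e × p x₃ ≡ e) ⊎ (p x₁ ≡ o × p x₂ ≡ o × p x₃ ≡ o) →
        𝒢 2 (x₁ ∷ x₂ ∷ x₃ ∷ []) ≡ 0) ×
      ((p x₁ ≡ e × p x₂ ≡ e × p x₃ ≡ o) ⊎ (p x₁ ≡ o × p x₂ ≡ o × p x₃ ≡ e) →
        𝒢 2 (x₁ ∷ x₂ ∷ x₃ ∷ []) ≡ 1) ×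
      ((p x₁ ≡ e × p x₂ ≡ o × p x₃ ≡ o) ⊎ (p x₁ ≡ o × p x₂ ≡ e × p x₃ ≡ e) →
        𝒢 2 (x₁ ∷ x₂ ∷ x₃ ∷ []) ≡ 2) ×
      ((p x₁ ≡ e × p x₂ ≡ o × p x₃ ≡ e) ⊎ (p x₁ ≡ o × p x₂ ≡ e × p x₃ ≡ o) →
        𝒢 2 (x₁ ∷ x₂ ∷ x₃ ∷ []) ≡ 3))
proposition7 =
  (λ x₁ x₂ x₁≤x₂ →
     two-piles x₁≤x₂ , two-piles x₁≤x₂ , two-piles x₁≤x₂ , two-piles x₁≤x₂) ,
  (λ x₁ x₂ x₃ x₁≤x₂ x₂≤x₃ →
     let table = three-piles x₁≤x₂ x₂≤x₃ in
     [ table , table ]′ , [ table , table ]′ , [ table , table ]′ , [ table , table ]′)
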